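{- Let $e$ be a positive integer. Then for all positive integers $n$, $|\mathcal C_e(\mathsf U_n)| \leqslant 2^{\binom{e}{2}}$.
   Context: For $a\in\mathbb Z$, $\overline{a}^{(e)}$ denotes the residue class of $a$ modulo $2^e$. $\mathsf U_n$ is the set of $n\times n$ matrices with entries in $\{1,-1\}$ and all diagonal entries equal to $1$. For a set $\mathsf M_n$ of $n\times n$ integer matrices, $\mathcal C_e(\mathsf M_n)$ is the set of tuples $\left(\overline{a_2}^{(e)},\dots,\overline{a_e}^{(e)}\right)$ such that $\det(xI-M)=\sum_{i=0}^n a_i x^{n-i}$ for some $M\in\mathsf M_n$ (with $a_i:=0$ for $i>n$). -}

module Defs where

open import Data.Nat as ℕ using (ℕ; zero; suc; _∸_; _^_; _≤ᵇ_)
open import Data.Nat.Properties using (m^n≢0)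
open import Data.Integer as ℤ using (ℤ; +_; -_; _%ℕ_)
open import Data.Fin using (Fin; zero; suc; toℕ; punchIn; _≟_)
open import Data.List using (List; []; _∷_; map)
open import Data.Vec using (Vec; tabulate)
open import Data.Bool using (if_then_else_)
open import Data.Product using (Σ; _×_)
open import Data.Sum using (_⊎_)
open import Relation.Nullary using (does)
open import Relation.Binary.PropositionalEquality using (_≡_)

Mat : ℕ → Set
Mat n = Fin n → Fin n → ℤ

InU : (n : ℕ) → Mat n → Set
InU n M = ((i j : Fin n) → (M i j ≡ + 1) ⊎ (M i j ≡ - (+ 1))) × ((i : Fin n) → M i i ≡ + 1)

-- Polynomials over ℤ as coefficient lists, lowest degree first
Poly : Set
Poly = List ℤ

_⊕_ : Poly → Poly → Poly
[] ⊕ q = q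
(a ∷ p) ⊕ [] = a ∷ p
(a ∷ p) ⊕ (b ∷ q) = (a ℤ.+ b) ∷ (p ⊕ q)

scale : ℤ → Poly → Poly
scale c p = map (c ℤ.*_) p

_⊗_ : Poly → Poly → Poly
[] ⊗ q = []
(a ∷ p) ⊗ q = scale a q ⊕ (+ 0 ∷ (p ⊗ q))

coeff : Poly → ℕ → ℤ
coeff [] k = + 0
coeff (a ∷ p) zero = a
coeff (a ∷ p) (suc k) = coeff p k

X : Poly
X = + 0 ∷ + 1 ∷ []

sumP : (n : ℕ) → (Fin n → Poly) → Poly
sumP zero f = []
sumP (suc n) f = f zero ⊕ sumP n (λ j → f (suc j))

sign : ℕ → ℤ
sign zero = + 1
sign (suc k) = - sign k

det : (n : ℕ) → (Fin n → Fin n → Poly) → Poly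
det zero A = + 1 ∷ []
det (suc n) A =
  sumP (suc n) (λ j → scale (sign (toℕ j)) (A zero j ⊗ det n (λ r c → A (suc r) (punchIn j c))))

charMat : (n : ℕ) → Mat n → Fin n → Fin n → Poly
charMat n M i j = (if does (i ≟ j) then X else []) ⊕ (- M i j ∷ [])

-- det(xI - M) = Σ_{i=0}^n a_i x^{n-i}, with a_i := 0 for i > n
charCoeff : (n : ℕ) → Mat n → ℕ → ℤ
charCoeff n M i = if i ≤ᵇ n then coeff (det n (charMat n M)) (n ∸ i) else + 0

-- The tuple (a_2 mod 2^e, …, a_e mod 2^e), residues represented by their
-- least nonnegative representative
resTuple : (e n : ℕ) → Mat n → Vec ℕ (e ∸ 1)
resTuple e n M = tabulate (λ k → _%ℕ_ (charCoeff n M (2 ℕ.+ toℕ k)) (2 ^ e) {{m^n≢0 2 e}})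

InC : (e n : ℕ) → Vec ℕ (e ∸ 1) → Set
InC e n t = Σ (Mat n) (λ M → InU n M × (resTuple e n M ≡ t))

-- Write xI − M = J + B where every entry of J is 1 and every entry of B lies in the ideal
-- 𝔪 = (2, x) of ℤ[x] (it is x − 2, 0 or −2).  Expanding det(J + B) row by row, a term using
-- two rows of J vanishes since J has equal rows, so every surviving term has at least n − 1
-- factors from 𝔪: det(xI − M) ∈ 𝔪^(n−1), i.e. 2^(k−1) divides a_k.  Hence a_k mod 2^e takes
-- at most 2^(e−k+1) values, and the tuples (a_2, …, a_e) mod 2^e number at most
-- 2^((e−1) + ⋯ + 1) = 2^(e choose 2).
module Submission where

open import Defs
open import Data.Nat using (ℕ; _≤_; _^_; _∸_; NonZero)
open import Data.Nat.Combinatorics using (_C_)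
open import Data.Vec using (Vec)
open import Data.List using (List; length)
open import Data.List.Relation.Unary.All using (All)
open import Data.List.Relation.Unary.Unique.Propositional using (Unique)

open import Algebra.Bundles using (AbelianGroup; CommutativeRing; RawGroup)
import Algebra.Consequences.Setoid as Consequences
import Algebra.Construct.Pointwise as Pointwise
open import Algebra.Definitions
  using (Associative; Commutative; Congruent₂; LeftIdentity; _DistributesOverʳ_)
import Algebra.Morphism.GroupMonomorphism as GroupMonomorphism
open import Algebra.Morphism.Structures using (IsGroupMonomorphism)
import Algebra.Properties.CommutativeSemigroup as CommutativeSemigroupProperties
open import Data.Bool using (true; false; if_then_else_; T)
open import Data.Fin using (Fin; zero; suc; toℕ; punchIn; lift; _≟_)
open import Data.Fin.Properties using (toℕ<n)
open import Data.Integer as ℤ using (ℤ; +_; -_; _+_; _*_; 0ℤ; 1ℤ; -1ℤ)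
open import Data.Integer.DivMod using (_%ℕ_; _/ℕ_; a≡a%ℕn+[a/ℕn]*n; n%ℕd<d)
open import Data.Integer.Divisibility.Signed
  using (_∣_; divides; ∣-trans; ∣m∣n⇒∣m+n; ∣m+n∣n⇒∣m; ∣n⇒∣m*n; *-monoʳ-∣; *-monoˡ-∣; ∣⇒∣ᵤ;
         module ∣-Reasoning)
import Data.Integer.Properties as ℤ
open import Data.List using ([]; _∷_; _++_; map; upTo; cartesianProductWith)
open import Data.List.Membership.Propositional using (_∈_; _─_)
open import Data.List.Membership.Propositional.Properties
  using (∈-map⁺; ∈-upTo⁺; ∈-cartesianProductWith⁺)
open import Data.List.Properties using (length-++; length-map; length-upTo; length-removeAt′)
open import Data.List.Relation.Binary.Subset.Propositional using (_⊆_)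
import Data.List.Relation.Unary.All as All
open import Data.List.Relation.Unary.AllPairs using (_∷_)
open import Data.List.Relation.Unary.Any using (here; there; index)
open import Data.Maybe as Maybe using (Maybe; just; nothing)
open import Data.Nat as ℕ using (zero; suc)
open import Data.Nat.Combinatorics using (nC1≡n; nCk+nC[k+1]≡[n+1]C[k+1])
import Data.Nat.Divisibility as ℕ
import Data.Nat.Properties as ℕ
open import Data.Product using (_,_)
open import Data.Sum using (_⊎_; inj₁; inj₂)
open import Data.Unit using (tt)
import Data.Vec as Vec
open import Data.Vec.Functional using (tail) renaming (_∷_ to _∷ᶠ_)
open import Data.Vec.Properties using (lookup∘tabulate)
open import Function using (_∘_; const; flip)
open import Level using (0ℓ)
open import Relation.Binary.PropositionalEquality
  using (_≡_; _≢_; _≗_; refl; sym; trans; cong; cong₂; subst; subst₂; module ≡-Reasoning)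
import Relation.Binary.Reasoning.Setoid as SetoidReasoning
open import Relation.Binary.Structures using (IsEquivalence)
open import Relation.Nullary using (does; contradiction)
open import Tactic.RingSolver using (solve-∀)
open import Tactic.RingSolver.Core.AlmostCommutativeRing
  using (AlmostCommutativeRing; fromCommutativeRing)

-- The ring ℤ[x] of coefficient lists up to trailing zeros

infix 4 _≈_
record _≈_ (p q : Poly) : Set where
  constructor coeffwise
  field coeff-≡ : ∀ k → coeff p k ≡ coeff q k
open _≈_

≈-isEquivalence : IsEquivalence _≈_
≈-isEquivalence = record
  { refl  = coeffwise λ _ → refl
  ; sym   = λ p≈q → coeffwise λ k → sym (coeff-≡ p≈q k)
  ; trans = λ p≈q q≈r → coeffwise λ k → trans (coeff-≡ p≈q k) (coeff-≡ q≈r k)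
  }

open IsEquivalence ≈-isEquivalence
  renaming (refl to ≈-refl; sym to ≈-sym; trans to ≈-trans; reflexive to ≈-reflexive)

∷-cong : ∀ {a b p q} → a ≡ b → p ≈ q → a ∷ p ≈ b ∷ q
∷-cong a≡b p≈q = coeffwise λ where
  zero    → a≡b
  (suc k) → coeff-≡ p≈q k

0∷-zero : ∀ {p} → p ≈ [] → 0ℤ ∷ p ≈ []
0∷-zero p≈[] = coeffwise λ where
  zero    → refl
  (suc k) → coeff-≡ p≈[] k

coeff-⊕ : ∀ p q k → coeff (p ⊕ q) k ≡ coeff p k + coeff q k
coeff-⊕ []      q       k       = sym (ℤ.+-identityˡ _)
coeff-⊕ (a ∷ p) []      k       = sym (ℤ.+-identityʳ _)
coeff-⊕ (a ∷ p) (b ∷ q) zero    = refl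
coeff-⊕ (a ∷ p) (b ∷ q) (suc k) = coeff-⊕ p q k

coeff-scale : ∀ c p k → coeff (scale c p) k ≡ c * coeff p k
coeff-scale c []      k       = sym (ℤ.*-zeroʳ c)
coeff-scale c (a ∷ p) zero    = refl
coeff-scale c (a ∷ p) (suc k) = coeff-scale c p k

neg : Poly → Poly
neg = scale -1ℤ

one : Poly
one = 1ℤ ∷ []

coeff-neg : ∀ p k → coeff (neg p) k ≡ - coeff p k
coeff-neg p k = trans (coeff-scale -1ℤ p k) (ℤ.-1*i≡-i (coeff p k))

ℤ^ℕ : AbelianGroup 0ℓ 0ℓ
ℤ^ℕ = Pointwise.abelianGroup ℕ ℤ.+-0-abelianGroup

Poly-rawGroup : RawGroup 0ℓ 0ℓ
Poly-rawGroup = record { Carrier = Poly ; _≈_ = _≈_ ; _∙_ = _⊕_ ; ε = [] ; _⁻¹ = neg }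

coeff-isGroupMonomorphism : IsGroupMonomorphism Poly-rawGroup (AbelianGroup.rawGroup ℤ^ℕ) coeff
coeff-isGroupMonomorphism = record
  { isGroupHomomorphism = record
    { isMonoidHomomorphism = record
      { isMagmaHomomorphism = record
        { isRelHomomorphism = record { cong = coeff-≡ }
        ; homo              = coeff-⊕
        }
      ; ε-homo = λ _ → refl
      }
    ; ⁻¹-homo = coeff-neg
    }
  ; injective = coeffwise
  }

Poly-+-abelianGroup : AbelianGroup 0ℓ 0ℓ
Poly-+-abelianGroup = record
  { isAbelianGroup = GroupMonomorphism.isAbelianGroup coeff-isGroupMonomorphism
                       (AbelianGroup.isAbelianGroup ℤ^ℕ)
  }

open AbelianGroup Poly-+-abelianGroup using (setoid; identityʳ; inverseʳ)
  renaming (∙-cong to ⊕-cong; ∙-congˡ to ⊕-congˡ; ∙-congʳ to ⊕-congʳ)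
open CommutativeSemigroupProperties (AbelianGroup.commutativeSemigroup Poly-+-abelianGroup)
  using (interchange; x∙yz≈y∙xz)

scale-congʳ : ∀ c {p q} → p ≈ q → scale c p ≈ scale c q
scale-congʳ c {p} {q} p≈q = coeffwise λ k →
  trans (coeff-scale c p k) (trans (cong (c *_) (coeff-≡ p≈q k)) (sym (coeff-scale c q k)))

scale-distribˡ : ∀ c p q → scale c (p ⊕ q) ≈ scale c p ⊕ scale c q
scale-distribˡ c []      q       = ≈-refl
scale-distribˡ c (a ∷ p) []      = ≈-refl
scale-distribˡ c (a ∷ p) (b ∷ q) = ∷-cong (ℤ.*-distribˡ-+ c a b) (scale-distribˡ c p q)

scale-distribʳ : ∀ c d p → scale (c + d) p ≈ scale c p ⊕ scale d p
scale-distribʳ c d []      = ≈-refl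
scale-distribʳ c d (a ∷ p) = ∷-cong (ℤ.*-distribʳ-+ a c d) (scale-distribʳ c d p)

scale-assoc : ∀ c d p → scale (c * d) p ≈ scale c (scale d p)
scale-assoc c d []      = ≈-refl
scale-assoc c d (a ∷ p) = ∷-cong (ℤ.*-assoc c d a) (scale-assoc c d p)

scale-comm : ∀ c d p → scale c (scale d p) ≈ scale d (scale c p)
scale-comm c d p = ≈-trans (≈-sym (scale-assoc c d p))
  (≈-trans (≈-reflexive (cong (λ e → scale e p) (ℤ.*-comm c d))) (scale-assoc d c p))

scale-zero : ∀ p → scale 0ℤ p ≈ []
scale-zero p = coeffwise (coeff-scale 0ℤ p)

scale-identity : ∀ p → scale 1ℤ p ≈ p
scale-identity p = coeffwise λ k → trans (coeff-scale 1ℤ p k) (ℤ.*-identityˡ (coeff p k))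

scale-neg : ∀ c p → scale (- c) p ≈ neg (scale c p)
scale-neg c p =
  ≈-trans (≈-reflexive (cong (λ d → scale d p) (sym (ℤ.-1*i≡-i c)))) (scale-assoc -1ℤ c p)

⊗-zeroʳ : ∀ p → p ⊗ [] ≈ []
⊗-zeroʳ []      = ≈-refl
⊗-zeroʳ (a ∷ p) = 0∷-zero (⊗-zeroʳ p)

⊗-congʳ : ∀ p {q q'} → q ≈ q' → p ⊗ q ≈ p ⊗ q'
⊗-congʳ []      q≈q' = ≈-refl
⊗-congʳ (a ∷ p) q≈q' = ⊕-cong (scale-congʳ a q≈q') (∷-cong refl (⊗-congʳ p q≈q'))

⊗-cons : ∀ p b q → p ⊗ (b ∷ q) ≈ scale b p ⊕ (0ℤ ∷ p ⊗ q)
⊗-cons []      b q = ≈-sym (0∷-zero ≈-refl)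
⊗-cons (a ∷ p) b q = ∷-cong (cong (_+ 0ℤ) (ℤ.*-comm a b))
  (≈-trans (⊕-congˡ (⊗-cons p b q)) (x∙yz≈y∙xz (scale a q) (scale b p) _))

⊗-comm : Commutative _≈_ _⊗_
⊗-comm []      q = ≈-sym (⊗-zeroʳ q)
⊗-comm (a ∷ p) q = ≈-trans (⊕-congˡ (∷-cong refl (⊗-comm p q))) (≈-sym (⊗-cons q a p))

⊗-cong : Congruent₂ _≈_ _⊗_
⊗-cong {p} {p'} {q} {q'} p≈p' q≈q' =
  ≈-trans (⊗-congʳ p q≈q') (≈-trans (⊗-comm p q') (≈-trans (⊗-congʳ q' p≈p') (⊗-comm q' p')))

⊗-distribʳ-⊕ : _DistributesOverʳ_ _≈_ _⊗_ _⊕_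
⊗-distribʳ-⊕ q []      p'        = ≈-refl
⊗-distribʳ-⊕ q (a ∷ p) []        = ≈-sym (identityʳ _)
⊗-distribʳ-⊕ q (a ∷ p) (a' ∷ p') = ≈-trans
  (⊕-cong (scale-distribʳ a a' q) (∷-cong refl (⊗-distribʳ-⊕ q p p')))
  (interchange (scale a q) (scale a' q) (0ℤ ∷ p ⊗ q) (0ℤ ∷ p' ⊗ q))

scale-⊗ : ∀ c p q → scale c p ⊗ q ≈ scale c (p ⊗ q)
scale-⊗ c []      q = ≈-refl
scale-⊗ c (a ∷ p) q = ≈-trans
  (⊕-cong (scale-assoc c a q) (∷-cong (sym (ℤ.*-zeroʳ c)) (scale-⊗ c p q)))
  (≈-sym (scale-distribˡ c (scale a q) (0ℤ ∷ p ⊗ q)))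

⊗-scale : ∀ c p q → p ⊗ scale c q ≈ scale c (p ⊗ q)
⊗-scale c p q =
  ≈-trans (⊗-comm p (scale c q)) (≈-trans (scale-⊗ c q p) (scale-congʳ c (⊗-comm q p)))

⊗-assoc : Associative _≈_ _⊗_
⊗-assoc []      q r = ≈-refl
⊗-assoc (a ∷ p) q r = ≈-trans (⊗-distribʳ-⊕ r (scale a q) (0ℤ ∷ p ⊗ q))
  (⊕-cong (scale-⊗ a q r) (≈-trans (⊕-congʳ (scale-zero r)) (∷-cong refl (⊗-assoc p q r))))

⊗-identityˡ : LeftIdentity _≈_ one _⊗_
⊗-identityˡ p = ≈-trans (⊕-cong (scale-identity p) (0∷-zero ≈-refl)) (identityʳ p)

Poly-commutativeRing : CommutativeRing 0ℓ 0ℓ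
Poly-commutativeRing = record
  { Carrier = Poly
  ; _≈_ = _≈_
  ; _+_ = _⊕_
  ; _*_ = _⊗_
  ; -_  = neg
  ; 0#  = []
  ; 1#  = one
  ; isCommutativeRing = record
    { isRing = record
      { +-isAbelianGroup = AbelianGroup.isAbelianGroup Poly-+-abelianGroup
      ; *-cong     = ⊗-cong
      ; *-assoc    = ⊗-assoc
      ; *-identity = comm∧idˡ⇒id ⊗-comm ⊗-identityˡ
      ; distrib    = comm∧distrʳ⇒distr ⊕-cong ⊗-comm ⊗-distribʳ-⊕
      }
    ; *-comm = ⊗-comm
    }
  }
  where open Consequences setoid using (comm∧idˡ⇒id; comm∧distrʳ⇒distr)

open CommutativeRing Poly-commutativeRing using (distribˡ; distribʳ)

-- The solver cancels a monomial only when this test recognises its coefficient as zero.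
Poly-almostCommutativeRing : AlmostCommutativeRing 0ℓ 0ℓ
Poly-almostCommutativeRing = fromCommutativeRing Poly-commutativeRing []≈?
  where
  []≈? : ∀ p → Maybe ([] ≈ p)
  []≈? []           = just ≈-refl
  []≈? (+ zero ∷ p) = Maybe.map (λ []≈p → ≈-sym (0∷-zero (≈-sym []≈p))) ([]≈? p)
  []≈? (_ ∷ p)      = nothing

≈-neg⇒≈[] : ∀ {p} → p ≈ neg p → p ≈ []
≈-neg⇒≈[] {p} p≈-p = coeffwise λ k → i≡-i⇒i≡0 (trans (coeff-≡ p≈-p k) (coeff-neg p k))
  where
  i≡-i⇒i≡0 : ∀ {i} → i ≡ - i → i ≡ 0ℤ
  i≡-i⇒i≡0 {+ zero}   _  = refl
  i≡-i⇒i≡0 {+ suc _}  ()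
  i≡-i⇒i≡0 {ℤ.-[1+ _ ]} ()

-- Determinants

sumP-cong : ∀ n {f g : Fin n → Poly} → (∀ j → f j ≈ g j) → sumP n f ≈ sumP n g
sumP-cong zero    f≈g = ≈-refl
sumP-cong (suc n) f≈g = ⊕-cong (f≈g zero) (sumP-cong n (f≈g ∘ suc))

sumP-⊕ : ∀ n (f g : Fin n → Poly) → sumP n (λ j → f j ⊕ g j) ≈ sumP n f ⊕ sumP n g
sumP-⊕ zero    f g = ≈-refl
sumP-⊕ (suc n) f g = ≈-trans (⊕-congˡ (sumP-⊕ n (f ∘ suc) (g ∘ suc)))
  (interchange (f zero) (g zero) (sumP n (f ∘ suc)) (sumP n (g ∘ suc)))

scale-sumP : ∀ c n (f : Fin n → Poly) → scale c (sumP n f) ≈ sumP n (scale c ∘ f)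
scale-sumP c zero    f = ≈-refl
scale-sumP c (suc n) f = ≈-trans (scale-distribˡ c (f zero) (sumP n (f ∘ suc)))
  (⊕-congˡ (scale-sumP c n (f ∘ suc)))

⊗-distribˡ-sumP : ∀ x n (f : Fin n → Poly) → x ⊗ sumP n f ≈ sumP n (λ j → x ⊗ f j)
⊗-distribˡ-sumP x zero    f = ⊗-zeroʳ x
⊗-distribˡ-sumP x (suc n) f = ≈-trans (distribˡ x (f zero) (sumP n (f ∘ suc)))
  (⊕-congˡ (⊗-distribˡ-sumP x n (f ∘ suc)))

altSum : ∀ n → (Fin n → Poly) → Poly
altSum n f = sumP n (λ j → scale (sign (toℕ j)) (f j))

altSum-cong : ∀ n {f g : Fin n → Poly} → (∀ j → f j ≈ g j) → altSum n f ≈ altSum n g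
altSum-cong n f≈g = sumP-cong n (λ j → scale-congʳ (sign (toℕ j)) (f≈g j))

altSum-suc : ∀ n (f : Fin (suc n) → Poly) → altSum (suc n) f ≈ f zero ⊕ neg (altSum n (f ∘ suc))
altSum-suc n f = ⊕-cong (scale-identity (f zero)) (≈-trans
  (sumP-cong n (λ j → scale-neg (sign (toℕ j)) (f (suc j))))
  (≈-sym (scale-sumP -1ℤ n (λ j → scale (sign (toℕ j)) (f (suc j))))))

altSum-⊕ : ∀ n (f g : Fin n → Poly) → altSum n (λ j → f j ⊕ g j) ≈ altSum n f ⊕ altSum n g
altSum-⊕ n f g =
  ≈-trans (sumP-cong n (λ j → scale-distribˡ (sign (toℕ j)) (f j) (g j))) (sumP-⊕ n _ _)

altSum-neg : ∀ n (f : Fin n → Poly) → altSum n (neg ∘ f) ≈ neg (altSum n f)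
altSum-neg n f = ≈-trans (sumP-cong n (λ j → scale-comm (sign (toℕ j)) -1ℤ (f j)))
  (≈-sym (scale-sumP -1ℤ n (λ j → scale (sign (toℕ j)) (f j))))

⊗-distribˡ-altSum : ∀ x n (f : Fin n → Poly) → x ⊗ altSum n f ≈ altSum n (λ j → x ⊗ f j)
⊗-distribˡ-altSum x n f = ≈-trans (⊗-distribˡ-sumP x n _)
  (sumP-cong n (λ j → ⊗-scale (sign (toℕ j)) x (f j)))

PolyMat : ℕ → Set
PolyMat n = Fin n → Fin n → Poly

minor : ∀ {n} → Fin (suc n) → PolyMat (suc n) → PolyMat n
minor j A r c = A (suc r) (punchIn j c)

det-cong : ∀ n {A B : PolyMat n} → (∀ i j → A i j ≈ B i j) → det n A ≈ det n B
det-cong zero    A≈B = ≈-refl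
det-cong (suc n) A≈B = altSum-cong (suc n) λ j →
  ⊗-cong (A≈B zero j) (det-cong n (λ r c → A≈B (suc r) (punchIn j c)))

det-row₀-affine : ∀ n (A : PolyMat (suc n)) c →
  det (suc n) A ≈ (c ⊗ det (suc n) (const one ∷ᶠ tail A))
                    ⊕ altSum (suc n) (λ j → (A zero j ⊕ neg c) ⊗ det n (minor j A))
det-row₀-affine n A c = begin
  altSum (suc n) (λ j → A zero j ⊗ D j)
    ≈⟨ altSum-cong (suc n) (λ j →
         ≈-trans (⊗-cong (split (A zero j) c) ≈-refl) (distribʳ (D j) c (A zero j ⊕ neg c))) ⟩
  altSum (suc n) (λ j → (c ⊗ D j) ⊕ ((A zero j ⊕ neg c) ⊗ D j))
    ≈⟨ altSum-⊕ (suc n) (λ j → c ⊗ D j) (λ j → (A zero j ⊕ neg c) ⊗ D j) ⟩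
  altSum (suc n) (λ j → c ⊗ D j) ⊕ altSum (suc n) (λ j → (A zero j ⊕ neg c) ⊗ D j)
    ≈⟨ ⊕-congʳ (≈-sym (⊗-distribˡ-altSum c (suc n) D)) ⟩
  (c ⊗ altSum (suc n) D) ⊕ altSum (suc n) (λ j → (A zero j ⊕ neg c) ⊗ D j)
    ≈⟨ ⊕-congʳ (⊗-congʳ c (altSum-cong (suc n) (λ j → ≈-sym (⊗-identityˡ (D j))))) ⟩
  (c ⊗ det (suc n) (const one ∷ᶠ tail A)) ⊕ altSum (suc n) (λ j → (A zero j ⊕ neg c) ⊗ D j) ∎
  where
  open SetoidReasoning setoid
  D : Fin (suc n) → Poly
  D j = det n (minor j A)
  split : ∀ p c → p ≈ c ⊕ (p ⊕ neg c)
  split = solve-∀ Poly-almostCommutativeRing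

-- G a b f is a term of the expansion along rows 0 and 1: these rows use columns a and b,
-- and f lists the remaining columns in increasing order.
DoubleSummand : ℕ → Set
DoubleSummand n = Fin (suc (suc n)) → Fin (suc (suc n)) → (Fin n → Fin (suc (suc n))) → Poly

doubleAltSum : ∀ n → DoubleSummand n → Poly
doubleAltSum n G =
  altSum (suc (suc n)) λ j → altSum (suc n) λ k → G j (punchIn j k) (punchIn j ∘ punchIn k)

-- The column lists of innerTerms (suc n) G and of doubleAltSum n (shift G) agree only pointwise.
ColumnExtensional : ∀ {n} → DoubleSummand n → Set
ColumnExtensional G = ∀ a b {f g} → f ≗ g → G a b f ≈ G a b g

leadingTerms : ∀ n → DoubleSummand n → Poly
leadingTerms n G = altSum (suc n) λ k → G zero (suc k) (suc ∘ punchIn k)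

innerTerms : ∀ n → DoubleSummand n → Poly
innerTerms n G = altSum (suc n) λ j → altSum n λ k →
  G (suc j) (suc (punchIn j k)) (punchIn (suc j) ∘ punchIn (suc k))

shift : ∀ {n} → DoubleSummand (suc n) → DoubleSummand n
shift G a b f = G (suc a) (suc b) (lift 1 f)

neg-cong : ∀ {p q} → p ≈ q → neg p ≈ neg q
neg-cong = scale-congʳ -1ℤ

doubleAltSum-split : ∀ n G →
  doubleAltSum n G ≈ leadingTerms n G ⊕ (neg (leadingTerms n (flip G)) ⊕ innerTerms n G)
doubleAltSum-split n G = begin
  doubleAltSum n G
    ≈⟨ altSum-suc (suc n) (λ j → altSum (suc n) (term j)) ⟩
  leadingTerms n G ⊕ neg (altSum (suc n) (λ j → altSum (suc n) (term (suc j))))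
    ≈⟨ ⊕-congˡ (neg-cong (altSum-cong (suc n) (λ j → altSum-suc n (term (suc j))))) ⟩
  leadingTerms n G ⊕ neg (altSum (suc n) (λ j → B j ⊕ neg (R j)))
    ≈⟨ ⊕-congˡ (neg-cong (≈-trans (altSum-⊕ (suc n) B (neg ∘ R))
                                   (⊕-congˡ (altSum-neg (suc n) R)))) ⟩
  leadingTerms n G ⊕ neg (leadingTerms n (flip G) ⊕ neg (innerTerms n G))
    ≈⟨ ⊕-congˡ (neg-over-sub (leadingTerms n (flip G)) (innerTerms n G)) ⟩
  leadingTerms n G ⊕ (neg (leadingTerms n (flip G)) ⊕ innerTerms n G) ∎
  where
  open SetoidReasoning setoid
  term : Fin (suc (suc n)) → Fin (suc n) → Poly
  term j k = G j (punchIn j k) (punchIn j ∘ punchIn k)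
  B : Fin (suc n) → Poly
  B j = term (suc j) zero
  R : Fin (suc n) → Poly
  R j = altSum n (term (suc j) ∘ suc)
  neg-over-sub : ∀ b r → neg (b ⊕ neg r) ≈ neg b ⊕ r
  neg-over-sub = solve-∀ Poly-almostCommutativeRing

innerTerms≈doubleAltSum-shift : ∀ n G → ColumnExtensional G →
  innerTerms (suc n) G ≈ doubleAltSum n (shift G)
innerTerms≈doubleAltSum-shift n G ext = altSum-cong (suc (suc n)) λ j → altSum-cong (suc n) λ k →
  ext (suc j) (suc (punchIn j k)) (punchIn-suc∘punchIn-suc j k)
  where
  punchIn-suc∘punchIn-suc : ∀ j k →
    punchIn (suc j) ∘ punchIn (suc k) ≗ lift 1 (punchIn j ∘ punchIn k)
  punchIn-suc∘punchIn-suc j k zero    = refl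
  punchIn-suc∘punchIn-suc j k (suc c) = refl

shift-extensional : ∀ {n} {G : DoubleSummand (suc n)} →
  ColumnExtensional G → ColumnExtensional (shift G)
shift-extensional ext a b f≗g = ext (suc a) (suc b) λ where
  zero    → refl
  (suc c) → cong suc (f≗g c)

doubleAltSum-antisym : ∀ n G → ColumnExtensional G →
  doubleAltSum n G ≈ neg (doubleAltSum n (flip G))
innerTerms-antisym : ∀ n G → ColumnExtensional G → innerTerms n G ≈ neg (innerTerms n (flip G))

doubleAltSum-antisym n G ext = begin
  doubleAltSum n G
    ≈⟨ doubleAltSum-split n G ⟩
  a ⊕ (neg b ⊕ innerTerms n G)
    ≈⟨ ⊕-congˡ {a} (⊕-congˡ {neg b} (innerTerms-antisym n G ext)) ⟩
  a ⊕ (neg b ⊕ neg (innerTerms n (flip G)))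
    ≈⟨ antisym a b (innerTerms n (flip G)) ⟩
  neg (b ⊕ (neg a ⊕ innerTerms n (flip G)))
    ≈⟨ neg-cong (doubleAltSum-split n (flip G)) ⟨
  neg (doubleAltSum n (flip G)) ∎
  where
  open SetoidReasoning setoid
  a b : Poly
  a = leadingTerms n G
  b = leadingTerms n (flip G)
  antisym : ∀ a b r → a ⊕ (neg b ⊕ neg r) ≈ neg (b ⊕ (neg a ⊕ r))
  antisym = solve-∀ Poly-almostCommutativeRing

innerTerms-antisym zero    G ext = ≈-refl
innerTerms-antisym (suc n) G ext = ≈-trans (innerTerms≈doubleAltSum-shift n G ext)
  (≈-trans (doubleAltSum-antisym n (shift G) (shift-extensional ext))
           (neg-cong (≈-sym (innerTerms≈doubleAltSum-shift n (flip G) (λ a b → ext b a)))))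

swap₀₁ : ∀ {n} {X : Set} → (Fin (suc (suc n)) → X) → Fin (suc (suc n)) → X
swap₀₁ A = A (suc zero) ∷ᶠ A zero ∷ᶠ tail (tail A)

det-as-doubleAltSum : ∀ n (A : PolyMat (suc (suc n))) →
  det (suc (suc n)) A ≈
    doubleAltSum n (λ a b f → A zero a ⊗ (A (suc zero) b ⊗ det n (λ r c → A (suc (suc r)) (f c))))
det-as-doubleAltSum n A = altSum-cong (suc (suc n)) λ j → ⊗-distribˡ-altSum (A zero j) (suc n)
  (λ k → A (suc zero) (punchIn j k) ⊗ det n (λ r c → A (suc (suc r)) (punchIn j (punchIn k c))))

det-swap₀₁ : ∀ n (A : PolyMat (suc (suc n))) →
  det (suc (suc n)) A ≈ neg (det (suc (suc n)) (swap₀₁ A))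
det-swap₀₁ n A = begin
  det (suc (suc n)) A
    ≈⟨ det-as-doubleAltSum n A ⟩
  doubleAltSum n (λ a b f → A zero a ⊗ (A (suc zero) b ⊗ Ψ f))
    ≈⟨ doubleAltSum-antisym n _ ext ⟩
  neg (doubleAltSum n (λ a b f → A zero b ⊗ (A (suc zero) a ⊗ Ψ f)))
    ≈⟨ neg-cong (altSum-cong (suc (suc n)) λ j → altSum-cong (suc n) λ k →
         ⊗-leftComm (A zero (punchIn j k)) (A (suc zero) j) (Ψ (punchIn j ∘ punchIn k))) ⟩
  neg (doubleAltSum n (λ a b f → A (suc zero) a ⊗ (A zero b ⊗ Ψ f)))
    ≈⟨ neg-cong (det-as-doubleAltSum n (swap₀₁ A)) ⟨
  neg (det (suc (suc n)) (swap₀₁ A)) ∎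
  where
  open SetoidReasoning setoid
  Ψ : (Fin n → Fin (suc (suc n))) → Poly
  Ψ f = det n (λ r c → A (suc (suc r)) (f c))
  ext : ColumnExtensional (λ a b f → A zero a ⊗ (A (suc zero) b ⊗ Ψ f))
  ext a b f≗g = ⊗-congʳ (A zero a) (⊗-congʳ (A (suc zero) b)
    (det-cong n (λ r c → ≈-reflexive (cong (A (suc (suc r))) (f≗g c)))))
  ⊗-leftComm : ∀ x y z → x ⊗ (y ⊗ z) ≈ y ⊗ (x ⊗ z)
  ⊗-leftComm = solve-∀ Poly-almostCommutativeRing

det-equalRows₀₁ : ∀ n (r : Fin (suc (suc n)) → Poly) (B : Fin n → Fin (suc (suc n)) → Poly) →
  det (suc (suc n)) (r ∷ᶠ r ∷ᶠ B) ≈ []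
det-equalRows₀₁ n r B = ≈-neg⇒≈[] (det-swap₀₁ n (r ∷ᶠ r ∷ᶠ B))

-- Powers of the ideal (2, x)

-- p ∈𝔪^ m: p lies in the m-th power of the ideal 𝔪 = (2, x) of ℤ[x].
infix 4 _∈𝔪^_
record _∈𝔪^_ (p : Poly) (m : ℕ) : Set where
  constructor coeffs-∣
  field coeff-∣ : ∀ k → + (2 ^ (m ∸ k)) ∣ coeff p k
open _∈𝔪^_

∣0 : ∀ {d} → d ∣ 0ℤ
∣0 = divides 0ℤ refl

1∣ : ∀ z → + 1 ∣ z
1∣ z = divides z (sym (ℤ.*-identityʳ z))

2^-split : ∀ {m n} → m ≤ n → 2 ^ n ≡ 2 ^ (n ∸ m) ℕ.* 2 ^ m
2^-split {m} {n} m≤n = trans (cong (2 ^_) (sym (ℕ.m∸n+n≡m m≤n))) (ℕ.^-distribˡ-+-* 2 (n ∸ m) m)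

2^-mono-∣ : ∀ {m n} → m ≤ n → + (2 ^ m) ∣ + (2 ^ n)
2^-mono-∣ {m} {n} m≤n =
  divides (+ (2 ^ (n ∸ m))) (trans (cong +_ (2^-split m≤n)) (ℤ.pos-* (2 ^ (n ∸ m)) (2 ^ m)))

m+n∸o≤m+[n∸o] : ∀ m n o → (m ℕ.+ n) ∸ o ≤ m ℕ.+ (n ∸ o)
m+n∸o≤m+[n∸o] m n       zero    = ℕ.≤-refl
m+n∸o≤m+[n∸o] m zero    (suc o) = ℕ.m∸n≤m (m ℕ.+ 0) (suc o)
m+n∸o≤m+[n∸o] m (suc n) (suc o) rewrite ℕ.+-suc m n = m+n∸o≤m+[n∸o] m n o

∈𝔪^-resp-≈ : ∀ {m p q} → p ≈ q → p ∈𝔪^ m → q ∈𝔪^ m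
∈𝔪^-resp-≈ p≈q p∈ = coeffs-∣ λ k → subst (_ ∣_) (coeff-≡ p≈q k) (coeff-∣ p∈ k)

∈𝔪^0 : ∀ {p} → p ∈𝔪^ 0
∈𝔪^0 {p} = coeffs-∣ λ k → subst (λ e → + (2 ^ e) ∣ coeff p k) (sym (ℕ.0∸n≡0 k)) (1∣ (coeff p k))

[]∈𝔪^ : ∀ {m} → [] ∈𝔪^ m
[]∈𝔪^ = coeffs-∣ λ _ → ∣0

∈𝔪^-mono : ∀ {m n p} → m ≤ n → p ∈𝔪^ n → p ∈𝔪^ m
∈𝔪^-mono m≤n p∈ = coeffs-∣ λ k → ∣-trans (2^-mono-∣ (ℕ.∸-monoˡ-≤ k m≤n)) (coeff-∣ p∈ k)

⊕-∈𝔪^ : ∀ {m p q} → p ∈𝔪^ m → q ∈𝔪^ m → p ⊕ q ∈𝔪^ m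
⊕-∈𝔪^ {p = p} {q} p∈ q∈ = coeffs-∣ λ k →
  subst (_ ∣_) (sym (coeff-⊕ p q k)) (∣m∣n⇒∣m+n (coeff-∣ p∈ k) (coeff-∣ q∈ k))

scale-∈𝔪^ : ∀ {a b c q} → + (2 ^ a) ∣ c → q ∈𝔪^ b → scale c q ∈𝔪^ (a ℕ.+ b)
scale-∈𝔪^ {a} {b} {c} {q} 2^a∣c q∈ = coeffs-∣ λ k → subst (_ ∣_) (sym (coeff-scale c q k)) (begin
  + (2 ^ ((a ℕ.+ b) ∸ k))             ∣⟨ 2^-mono-∣ (m+n∸o≤m+[n∸o] a b k) ⟩
  + (2 ^ (a ℕ.+ (b ∸ k)))             ≡⟨ cong +_ (ℕ.^-distribˡ-+-* 2 a (b ∸ k)) ⟩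
  + (2 ^ a ℕ.* 2 ^ (b ∸ k))           ≡⟨ ℤ.pos-* (2 ^ a) (2 ^ (b ∸ k)) ⟩
  + (2 ^ a) * + (2 ^ (b ∸ k))         ∣⟨ *-monoˡ-∣ (+ (2 ^ (b ∸ k))) 2^a∣c ⟩
  c * + (2 ^ (b ∸ k))                 ∣⟨ *-monoʳ-∣ c (coeff-∣ q∈ k) ⟩
  c * coeff q k                       ∎)
  where open ∣-Reasoning

scale-pres-∈𝔪^ : ∀ {m q} c → q ∈𝔪^ m → scale c q ∈𝔪^ m
scale-pres-∈𝔪^ c = scale-∈𝔪^ {0} (1∣ c)

0∷-∈𝔪^ : ∀ {m p} → p ∈𝔪^ m → 0ℤ ∷ p ∈𝔪^ suc m
0∷-∈𝔪^ p∈ = coeffs-∣ λ where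
  zero    → ∣0
  (suc k) → coeff-∣ p∈ k

∷-∈𝔪^⇒∈𝔪^ : ∀ {m a p} → a ∷ p ∈𝔪^ suc m → p ∈𝔪^ m
∷-∈𝔪^⇒∈𝔪^ a∷p∈ = coeffs-∣ λ k → coeff-∣ a∷p∈ (suc k)

⊗-∈𝔪^ : ∀ {a b p q} → p ∈𝔪^ a → q ∈𝔪^ b → p ⊗ q ∈𝔪^ (a ℕ.+ b)
⊗-∈𝔪^ {p = []}    p∈ q∈ = []∈𝔪^
⊗-∈𝔪^ {a} {b} {x ∷ p} {q} p∈ q∈ = ⊕-∈𝔪^ (scale-∈𝔪^ (coeff-∣ p∈ 0) q∈) (shifted a p∈)
  where
  shifted : ∀ a → x ∷ p ∈𝔪^ a → 0ℤ ∷ (p ⊗ q) ∈𝔪^ (a ℕ.+ b)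
  shifted zero    _  = ∈𝔪^-mono (ℕ.n≤1+n b) (0∷-∈𝔪^ (⊗-∈𝔪^ {0} {p = p} ∈𝔪^0 q∈))
  shifted (suc a) p∈ = 0∷-∈𝔪^ (⊗-∈𝔪^ (∷-∈𝔪^⇒∈𝔪^ p∈) q∈)

sumP-∈𝔪^ : ∀ {m} n {f : Fin n → Poly} → (∀ j → f j ∈𝔪^ m) → sumP n f ∈𝔪^ m
sumP-∈𝔪^ zero    f∈ = []∈𝔪^
sumP-∈𝔪^ (suc n) f∈ = ⊕-∈𝔪^ (f∈ zero) (sumP-∈𝔪^ n (f∈ ∘ suc))

altSum-∈𝔪^ : ∀ {m} n {f : Fin n → Poly} → (∀ j → f j ∈𝔪^ m) → altSum n f ∈𝔪^ m
altSum-∈𝔪^ n f∈ = sumP-∈𝔪^ n (λ j → scale-pres-∈𝔪^ (sign (toℕ j)) (f∈ j))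

RowsConstMod𝔪 : ∀ {m n} → (Fin m → Fin n → Poly) → (Fin m → Poly) → Set
RowsConstMod𝔪 A c = ∀ i j → A i j ⊕ neg (c i) ∈𝔪^ 1

det-∈𝔪^ : ∀ n (A : PolyMat (suc n)) c → RowsConstMod𝔪 A c → det (suc n) A ∈𝔪^ n
det-onesRow-∈𝔪^ : ∀ n (B : Fin (suc n) → Fin (suc (suc n)) → Poly) c →
  RowsConstMod𝔪 B c → det (suc (suc n)) (const one ∷ᶠ B) ∈𝔪^ suc n

det-∈𝔪^ zero    A c A≡c = ∈𝔪^0
det-∈𝔪^ (suc n) A c A≡c =
  ∈𝔪^-resp-≈ (≈-sym (det-row₀-affine (suc n) A (c zero))) (⊕-∈𝔪^ onesRow-part minors-part)
  where
  onesRow-part : c zero ⊗ det (suc (suc n)) (const one ∷ᶠ tail A) ∈𝔪^ suc n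
  onesRow-part = ⊗-∈𝔪^ {0} {p = c zero} ∈𝔪^0 (det-onesRow-∈𝔪^ n (tail A) (tail c) (A≡c ∘ suc))
  minors-part : altSum (suc (suc n)) (λ j → (A zero j ⊕ neg (c zero)) ⊗ det (suc n) (minor j A))
                  ∈𝔪^ suc n
  minors-part = altSum-∈𝔪^ (suc (suc n)) λ j → ⊗-∈𝔪^ (A≡c zero j)
    (det-∈𝔪^ n (minor j A) (tail c) λ r k → A≡c (suc r) (punchIn j k))

-- Swap the row of ones with B's first row and expand along the latter: its constant part
-- multiplies a determinant with two rows of ones.
det-onesRow-∈𝔪^ n B c B≡c =
  ∈𝔪^-resp-≈ (≈-sym (det-swap₀₁ n (const one ∷ᶠ B))) (scale-pres-∈𝔪^ -1ℤ
    (∈𝔪^-resp-≈ (≈-sym (det-row₀-affine (suc n) A (c zero))) (⊕-∈𝔪^ onesRows-part minors-part)))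
  where
  A : PolyMat (suc (suc n))
  A = swap₀₁ (const one ∷ᶠ B)
  onesRows-part : c zero ⊗ det (suc (suc n)) (const one ∷ᶠ tail A) ∈𝔪^ suc n
  onesRows-part = ∈𝔪^-resp-≈
    (≈-sym (≈-trans (⊗-congʳ (c zero) (det-equalRows₀₁ n (const one) (tail B))) (⊗-zeroʳ (c zero))))
    []∈𝔪^
  minor-rowsConst : ∀ j → RowsConstMod𝔪 (minor j A) (one ∷ᶠ tail c)
  minor-rowsConst j zero    k = ∈𝔪^-resp-≈ (≈-sym (inverseʳ one)) []∈𝔪^
  minor-rowsConst j (suc r) k = B≡c (suc r) (punchIn j k)
  minors-part : altSum (suc (suc n)) (λ j → (A zero j ⊕ neg (c zero)) ⊗ det (suc n) (minor j A))
                  ∈𝔪^ suc n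
  minors-part = altSum-∈𝔪^ (suc (suc n)) λ j → ⊗-∈𝔪^ (B≡c zero j)
    (det-∈𝔪^ n (minor j A) (one ∷ᶠ tail c) (minor-rowsConst j))

even-constant⇒∈𝔪 : ∀ {p} → + 2 ∣ coeff p 0 → p ∈𝔪^ 1
even-constant⇒∈𝔪 {p} 2∣p₀ = coeffs-∣ λ where
  zero    → 2∣p₀
  (suc k) → subst (λ e → + (2 ^ e) ∣ coeff p (suc k)) (sym (ℕ.0∸n≡0 k)) (1∣ (coeff p (suc k)))

charMat-rowsConst : ∀ n M → InU n M → RowsConstMod𝔪 (charMat n M) (const one)
charMat-rowsConst n M (±1 , _) i j = even-constant⇒∈𝔪 (constant-term-even (does (i ≟ j)) (±1 i j))
  where
  constant-term-even : ∀ b {m} → m ≡ + 1 ⊎ m ≡ - + 1 →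
    + 2 ∣ coeff (((if b then X else []) ⊕ (- m ∷ [])) ⊕ neg one) 0
  constant-term-even true  (inj₁ refl) = divides -1ℤ refl
  constant-term-even true  (inj₂ refl) = ∣0
  constant-term-even false (inj₁ refl) = divides -1ℤ refl
  constant-term-even false (inj₂ refl) = ∣0

charPoly-∈𝔪^ : ∀ n M → InU (suc n) M → det (suc n) (charMat (suc n) M) ∈𝔪^ n
charPoly-∈𝔪^ n M M∈U = det-∈𝔪^ n (charMat (suc n) M) (const one) (charMat-rowsConst (suc n) M M∈U)

charCoeff-∣ : ∀ n M → InU (suc n) M → ∀ k → + (2 ^ suc k) ∣ charCoeff (suc n) M (2 ℕ.+ k)
charCoeff-∣ n M M∈U k = if-∣ ((2 ℕ.+ k) ℕ.≤ᵇ suc n) λ 2+k≤ᵇ1+n →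
  subst (λ e → + (2 ^ e) ∣ coeff (det (suc n) (charMat (suc n) M)) (n ∸ suc k))
    (ℕ.m∸[m∸n]≡n (ℕ.s≤s⁻¹ (ℕ.≤ᵇ⇒≤ (2 ℕ.+ k) (suc n) 2+k≤ᵇ1+n)))
    (coeff-∣ (charPoly-∈𝔪^ n M M∈U) (n ∸ suc k))
  where
  if-∣ : ∀ b {d x} → (T b → d ∣ x) → d ∣ (if b then x else + 0)
  if-∣ true  d∣x = d∣x tt
  if-∣ false _   = ∣0

-- Counting

%ℕ-∈-multiples : ∀ {z d} q D .{{_ : NonZero D}} → D ≡ q ℕ.* d → + d ∣ z →
  z %ℕ D ∈ map (ℕ._* d) (upTo q)
%ℕ-∈-multiples {z} {d} q D D≡q*d d∣z =
  subst (_∈ map (ℕ._* d) (upTo q)) (sym r≡t*d) (∈-map⁺ (ℕ._* d) (∈-upTo⁺ t<q))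
  where
  d∣D : + d ∣ + D
  d∣D = divides (+ q) (trans (cong +_ D≡q*d) (ℤ.pos-* q d))
  d∣r : + d ∣ + (z %ℕ D)
  d∣r = ∣m+n∣n⇒∣m (subst (+ d ∣_) (a≡a%ℕn+[a/ℕn]*n z D) d∣z) (∣n⇒∣m*n (z /ℕ D) d∣D)
  t : ℕ
  t = ℕ._∣_.quotient (∣⇒∣ᵤ d∣r)
  r≡t*d : z %ℕ D ≡ t ℕ.* d
  r≡t*d = ℕ._∣_.equality (∣⇒∣ᵤ d∣r)
  t<q : t ℕ.< q
  t<q = ℕ.*-cancelʳ-< d t q (subst₂ ℕ._<_ r≡t*d D≡q*d (n%ℕd<d z D))

cartesianVecs : ∀ {A : Set} {m} → (Fin m → List A) → List (Vec A m)
cartesianVecs {m = zero}  S = Vec.[] ∷ []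
cartesianVecs {m = suc m} S = cartesianProductWith Vec._∷_ (S zero) (cartesianVecs (S ∘ suc))

∈-cartesianVecs : ∀ {A : Set} {m} (S : Fin m → List A) (v : Vec A m) →
  (∀ k → Vec.lookup v k ∈ S k) → v ∈ cartesianVecs S
∈-cartesianVecs {m = zero}  S Vec.[]       _ = here refl
∈-cartesianVecs {m = suc m} S (x Vec.∷ v) v∈S =
  ∈-cartesianProductWith⁺ Vec._∷_ (v∈S zero) (∈-cartesianVecs (S ∘ suc) v (v∈S ∘ suc))

length-cartesianProductWith : ∀ {A B C : Set} (f : A → B → C) xs ys →
  length (cartesianProductWith f xs ys) ≡ length xs ℕ.* length ys
length-cartesianProductWith f []       ys = refl
length-cartesianProductWith f (x ∷ xs) ys = begin
  length (map (f x) ys ++ cartesianProductWith f xs ys)  ≡⟨ length-++ (map (f x) ys) ⟩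
  length (map (f x) ys) ℕ.+ length (cartesianProductWith f xs ys)
    ≡⟨ cong₂ ℕ._+_ (length-map (f x) ys) (length-cartesianProductWith f xs ys) ⟩
  length ys ℕ.+ length xs ℕ.* length ys  ∎
  where open ≡-Reasoning

length-cartesianVecs-staircase : ∀ {A : Set} m (S : Fin m → List A) →
  (∀ k → length (S k) ≡ 2 ^ (m ∸ toℕ k)) → length (cartesianVecs S) ≡ 2 ^ (suc m C 2)
length-cartesianVecs-staircase zero    S |S| = refl
length-cartesianVecs-staircase (suc m) S |S| = begin
  length (cartesianVecs S)                   ≡⟨ length-cartesianProductWith Vec._∷_ (S zero) _ ⟩
  length (S zero) ℕ.* length (cartesianVecs (S ∘ suc))
    ≡⟨ cong₂ ℕ._*_ (|S| zero) (length-cartesianVecs-staircase m (S ∘ suc) (|S| ∘ suc)) ⟩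
  2 ^ suc m ℕ.* 2 ^ (suc m C 2)              ≡⟨ ℕ.^-distribˡ-+-* 2 (suc m) (suc m C 2) ⟨
  2 ^ (suc m ℕ.+ suc m C 2)                  ≡⟨ cong (λ e → 2 ^ (e ℕ.+ suc m C 2)) (nC1≡n (suc m)) ⟨
  2 ^ (suc m C 1 ℕ.+ suc m C 2)              ≡⟨ cong (2 ^_) (nCk+nC[k+1]≡[n+1]C[k+1] (suc m) 1) ⟩
  2 ^ (suc (suc m) C 2)                      ∎
  where open ≡-Reasoning

∈-─⁺ : ∀ {A : Set} {x y : A} {ys} (x∈ys : x ∈ ys) → y ∈ ys → x ≢ y → y ∈ ys ─ x∈ys
∈-─⁺ (here refl) (here refl) x≢y = contradiction refl x≢y
∈-─⁺ (here refl) (there y∈ys) _  = y∈ys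
∈-─⁺ (there _)   (here refl) _   = here refl
∈-─⁺ (there x∈ys) (there y∈ys) x≢y = there (∈-─⁺ x∈ys y∈ys x≢y)

unique-⊆⇒length≤ : ∀ {A : Set} {xs ys : List A} → Unique xs → xs ⊆ ys → length xs ≤ length ys
unique-⊆⇒length≤ {xs = []}     _               _     = ℕ.z≤n
unique-⊆⇒length≤ {xs = x ∷ xs} {ys} (x∉xs ∷ xs!) xs⊆ys = begin
  suc (length xs)            ≤⟨ ℕ.s≤s (unique-⊆⇒length≤ xs! xs⊆ys─x) ⟩
  suc (length (ys ─ x∈ys))   ≡⟨ length-removeAt′ ys (index x∈ys) ⟨
  length ys                  ∎
  where
  open ℕ.≤-Reasoning
  x∈ys : x ∈ ys
  x∈ys = xs⊆ys (here refl)
  xs⊆ys─x : xs ⊆ ys ─ x∈ys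
  xs⊆ys─x y∈xs = ∈-─⁺ x∈ys (xs⊆ys (there y∈xs)) (All.lookup x∉xs y∈xs)

-- The possible residues of a_(k+2) modulo 2^(e+1), which are multiples of 2^(k+1).
residueCandidates : ∀ e → Fin e → List ℕ
residueCandidates e k = map (ℕ._* 2 ^ suc (toℕ k)) (upTo (2 ^ (e ∸ toℕ k)))

length-residueCandidates : ∀ e k → length (residueCandidates e k) ≡ 2 ^ (e ∸ toℕ k)
length-residueCandidates e k = trans (length-map _ (upTo (2 ^ (e ∸ toℕ k)))) (length-upTo _)

inC⇒∈residueCandidates : ∀ e n {t} → InC (suc e) (suc n) t → t ∈ cartesianVecs (residueCandidates e)
inC⇒∈residueCandidates e n (M , M∈U , refl) = ∈-cartesianVecs (residueCandidates e) _ λ k →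
  subst (_∈ residueCandidates e k) (sym (lookup∘tabulate _ k))
    (%ℕ-∈-multiples (2 ^ (e ∸ toℕ k)) (2 ^ suc e) {{ℕ.m^n≢0 2 (suc e)}}
      (2^-split (ℕ.m≤n⇒m≤1+n (toℕ<n k))) (charCoeff-∣ n M M∈U (toℕ k)))

lemma3p1 : (e : ℕ) → .{{_ : NonZero e}} → (n : ℕ) → .{{_ : NonZero n}} →
    (L : List (Vec ℕ (e ∸ 1))) → Unique L → All (InC e n) L →
    length L ≤ 2 ^ (e C 2)
lemma3p1 (suc e) (suc n) L L! L⊆C = begin
  length L
    ≤⟨ unique-⊆⇒length≤ L! (λ t∈L → inC⇒∈residueCandidates e n (All.lookup L⊆C t∈L)) ⟩
  length (cartesianVecs (residueCandidates e))
    ≡⟨ length-cartesianVecs-staircase e (residueCandidates e) (length-residueCandidates e) ⟩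
  2 ^ (suc e C 2) ∎
  where open ℕ.≤-Reasoning
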